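{- Let $g:\mathbb{N}\to\mathbb{N}$ be a function such that for every $x\in\mathbb{N}$, every tournament $T'$ with $\overrightarrow{\omega}(T')\ge g(x)$ has a vertex whose out-neighbourhood has clique number at least $x$ and a vertex whose in-neighbourhood has clique number at least $x$. Let $b$ and $C$ be positive integers and let $T$ be a tournament with $\overrightarrow{\omega}(T)=2g(b)+C$. Let $B\subseteq V(T)$ be the set of vertices $v$ with $\overrightarrow{\omega}(N^-(v))\geq b$ and $\overrightarrow{\omega}(N^+(v))\geq b$. Then $\overrightarrow{\omega}(B)\geq C$; in particular $B$ is nonempty.
   Context: A tournament is a finite directed graph with exactly one arc between each pair of distinct vertices; $N^+(v)$, $N^-(v)$ denote the out- and in-neighbourhoods of $v$. For a total ordering $<$ of $V(T)$, the backedge graph $B(T,<)$ is the graph on $V(T)$ with an edge $uv$ for every pair $u<v$ with $vu \in A(T)$; $\overrightarrow{\omega}(T)=\min_<\omega(B(T,<))$ over all total orderings. For $X\subseteq V(T)$, $\overrightarrow{\omega}(X)$ denotes $\overrightarrow{\omega}(T[X])$. (Such a function $g$ exists.) -}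

module Defs where

open import Data.Nat using (ℕ; _≤_)
open import Data.Fin using (Fin)
open import Data.Bool using (Bool; true; false)
open import Data.List using (List; _∷_; _++_; length)
open import Data.List.Membership.Propositional using (_∈_)
open import Data.List.Relation.Unary.Unique.Propositional using (Unique)
open import Data.Product using (Σ; ∃; _×_; _,_)
open import Data.Sum using (_⊎_)
open import Data.Unit using (⊤)
open import Relation.Binary.PropositionalEquality using (_≡_; _≢_)
open import Function.Bundles using (_⇔_)

-- A tournament on vertex set Fin n: arc u v ≡ true means u → v is an arc.
record Tournament (n : ℕ) : Set where
  field
    arc     : Fin n → Fin n → Bool
    irrefl  : ∀ u → arc u u ≡ false
    total   : ∀ u v → u ≢ v → (arc u v ≡ true) ⊎ (arc v u ≡ true)
    antisym : ∀ u v → arc u v ≡ true → arc v u ≡ false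

module _ {n : ℕ} (T : Tournament n) where
  open Tournament T

  Arc : Fin n → Fin n → Set
  Arc u v = arc u v ≡ true

  VSet : Set₁
  VSet = Fin n → Set

  Vall : VSet
  Vall _ = ⊤

  N⁺ : Fin n → VSet
  N⁺ v w = Arc v w

  N⁻ : Fin n → VSet
  N⁻ v w = Arc w v

  -- a total ordering of X ⊆ V(T): a duplicate-free list of exactly the elements of X
  IsOrdering : VSet → List (Fin n) → Set
  IsOrdering X L = Unique L × (∀ v → X v ⇔ v ∈ L)

  Precedes : List (Fin n) → Fin n → Fin n → Set
  Precedes L u v = Σ (List (Fin n)) λ xs → Σ (List (Fin n)) λ ys → (L ≡ xs ++ (u ∷ ys)) × v ∈ ys

  -- edge uv of the backedge graph B(T[X], L): u < v and vu ∈ A(T) (either orientation of the pair)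
  BackEdge : List (Fin n) → Fin n → Fin n → Set
  BackEdge L u v = (Precedes L u v × Arc v u) ⊎ (Precedes L v u × Arc u v)

  IsClique : List (Fin n) → List (Fin n) → Set
  IsClique L K = Unique K × (∀ u → u ∈ K → u ∈ L)
                 × (∀ u v → u ∈ K → v ∈ K → u ≢ v → BackEdge L u v)

  IsCliqueNumber : List (Fin n) → ℕ → Set
  IsCliqueNumber L m = (∃ λ K → IsClique L K × length K ≡ m)
                       × (∀ K → IsClique L K → length K ≤ m)

  IsOmegaVec : VSet → ℕ → Set
  IsOmegaVec X m = (∃ λ L → IsOrdering X L × IsCliqueNumber L m)
                   × (∀ L m' → IsOrdering X L → IsCliqueNumber L m' → m ≤ m')

  OmegaVec≥ : VSet → ℕ → Set
  OmegaVec≥ X k = ∃ λ m → IsOmegaVec X m × k ≤ m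

  BigSet : ℕ → VSet
  BigSet b v = OmegaVec≥ (N⁻ v) b × OmegaVec≥ (N⁺ v) b

-- Let A⁺ (A⁻) be the set of vertices whose out- (in-)neighbourhood has ω⃗ < b. Every S ⊆ A⁺ has
-- ω⃗(S) < g(b): otherwise the hypothesis on g, applied to T[S], yields a vertex of S whose
-- out-neighbourhood inside S, and hence in T, has ω⃗ ≥ b. The same holds inside A⁻. A vertex outside B
-- lies in A⁺ or in A⁻, and ω⃗ is subadditive (concatenate orderings of the parts; a clique of the
-- backedge graph of the concatenation splits into cliques of the parts), so
--   2 g(b) + C = ω⃗(V) ≤ ω⃗(B) + ω⃗(V ∖ B) ≤ ω⃗(B) + 2 g(b).

module Submission where

open import Defs
open import Data.Bool using (true)
import Data.Bool.Properties as Bool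
open import Data.Fin using (Fin; zero; suc)
open import Data.Fin.Properties using (_≟_; all?)
open import Data.List
  using (List; []; _∷_; [_]; _++_; length; map; filter; allFin; lookup; cartesianProductWith)
open import Data.List.Extrema.Nat
  using (argmin; argmax; argmin-all; argmax-all; f[argmin]≤f[xs]; f[xs]≤f[argmax])
open import Data.List.Membership.Propositional using (_∈_)
open import Data.List.Membership.Propositional.Properties
  using (∈-++⁺ˡ; ∈-++⁺ʳ; ∈-++⁻; ∈-map⁺; ∈-map⁻; ∈-filter⁺; ∈-filter⁻; ∈-allFin; ∈-lookup;
         ∈-cartesianProductWith⁺)
open import Data.List.Membership.Propositional.Properties.WithK using (unique∧set⇒bag)
open import Data.List.Properties using (length-map)
open import Data.List.Relation.Binary.BagAndSetEquality using (_∼[_]_; set; ∼bag⇒↭)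
open import Data.List.Relation.Binary.Permutation.Propositional.Properties using (↭-length)
open import Data.List.Relation.Binary.Sublist.Propositional
  using (_⊆_; []; _∷_; _∷ʳ_; ⊆-refl; ⊆-trans; from∈; to∈)
  renaming (lookup to ⊆-lookup)
open import Data.List.Relation.Binary.Sublist.Propositional.Properties
  using (∷ˡ⁻; filter-⊆; ++⁺ˡ; ++⁺ʳ; map⁺)
import Data.List.Relation.Binary.Sublist.Heterogeneous as Sublist
import Data.List.Relation.Binary.Sublist.Heterogeneous.Properties as Sublist
open import Data.List.Relation.Unary.All as All using (All; []; _∷_)
open import Data.List.Relation.Unary.All.Properties using (all-filter)
open import Data.List.Relation.Unary.AllPairs using ([]; _∷_)
open import Data.List.Relation.Unary.Any using (here; there; index)
open import Data.List.Relation.Unary.Any.Properties using (lookup-index)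
open import Data.List.Relation.Unary.Unique.Propositional using (Unique)
open import Data.List.Relation.Unary.Unique.Propositional.Properties as Unique
  using (filter⁺; allFin⁺)
open import Data.Nat using (ℕ; zero; suc; _+_; _*_; _≤_; _<_; _≤?_; NonZero; >-nonZero⁻¹)
open import Data.Nat.Properties
  using (≤-reflexive; ≤-trans; ≤-antisym; +-mono-≤; +-monoʳ-≤; +-comm; +-suc; +-identityʳ; +-cancelʳ-≤; <⇒≤; ≰⇒>;
         module ≤-Reasoning)
open import Data.Product as Product using (∃; _×_; _,_; proj₁; proj₂)
open import Data.Sum as Sum using (_⊎_; inj₁; inj₂; [_,_]′)
open import Data.Unit using (tt)
open import Function using (_∘_; _⇔_; mk⇔; Injective)
open import Function.Bundles using (module Equivalence)
import Function.Properties.Equivalence as ⇔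
open import Relation.Binary.PropositionalEquality using (_≡_; _≢_; refl; sym; trans; cong; subst)
open import Relation.Nullary using (Dec; yes; no; ¬_; ¬?; contradiction)
open import Relation.Nullary.Decidable as Dec using (_×-dec_; _⊎-dec_; _→-dec_; decidable-stable)
open import Relation.Unary using (Decidable; _∩_; ∁)
open import Relation.Unary.Properties using (_∩?_; ∁?)

open Equivalence using (to; from)

module _ {A : Set} where

  sublists : List A → List (List A)
  sublists []       = [ [] ]
  sublists (x ∷ xs) = map (x ∷_) (sublists xs) ++ sublists xs

  ∈-sublists : ∀ {xs ys : List A} → xs ⊆ ys → xs ∈ sublists ys
  ∈-sublists []         = here refl
  ∈-sublists (y ∷ʳ τ)   = ∈-++⁺ʳ _ (∈-sublists τ)
  ∈-sublists (refl ∷ τ) = ∈-++⁺ˡ (∈-map⁺ _ (∈-sublists τ))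

  listsOfLength : List A → ℕ → List (List A)
  listsOfLength xs zero    = [ [] ]
  listsOfLength xs (suc k) = cartesianProductWith _∷_ xs (listsOfLength xs k)

  ∈-listsOfLength : ∀ {xs ys : List A} → All (_∈ xs) ys → ys ∈ listsOfLength xs (length ys)
  ∈-listsOfLength []       = here refl
  ∈-listsOfLength (p ∷ ps) = ∈-cartesianProductWith⁺ _∷_ p (∈-listsOfLength ps)

  ⊆-pair-total : ∀ {u v : A} {xs} → u ∈ xs → v ∈ xs → u ≢ v → u ∷ [ v ] ⊆ xs ⊎ v ∷ [ u ] ⊆ xs
  ⊆-pair-total (here refl)  (here refl)  u≢v = contradiction refl u≢v
  ⊆-pair-total (here refl)  (there v∈xs) _   = inj₁ (refl ∷ from∈ v∈xs)
  ⊆-pair-total (there u∈xs) (here refl)  _   = inj₂ (refl ∷ from∈ u∈xs)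
  ⊆-pair-total (there u∈xs) (there v∈xs) u≢v = Sum.map (_ ∷ʳ_) (_ ∷ʳ_) (⊆-pair-total u∈xs v∈xs u≢v)

  Unique⇒⊆-pair-asym : ∀ {u v : A} {xs} → Unique xs → u ∷ [ v ] ⊆ xs → ¬ v ∷ [ u ] ⊆ xs
  Unique⇒⊆-pair-asym (_ ∷ xs!)  (_ ∷ʳ τ)   (_ ∷ʳ σ)  = Unique⇒⊆-pair-asym xs! τ σ
  Unique⇒⊆-pair-asym (x∉xs ∷ _) (refl ∷ _) (_ ∷ʳ σ)  = All.lookup x∉xs (to∈ (∷ˡ⁻ σ)) refl
  Unique⇒⊆-pair-asym (x∉xs ∷ _) (_ ∷ʳ τ)   (refl ∷ _) = All.lookup x∉xs (to∈ (∷ˡ⁻ τ)) refl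
  Unique⇒⊆-pair-asym (x∉xs ∷ _) (refl ∷ τ) (refl ∷ _) = All.lookup x∉xs (to∈ τ) refl

  Unique∧set⇒length≡ : ∀ {xs ys : List A} → Unique xs → Unique ys → xs ∼[ set ] ys → length xs ≡ length ys
  Unique∧set⇒length≡ xs! ys! xs∼ys = ↭-length (∼bag⇒↭ (unique∧set⇒bag xs! ys! xs∼ys))

  Unique⇒lookup-injective : ∀ {xs : List A} → Unique xs → Injective _≡_ _≡_ (lookup xs)
  Unique⇒lookup-injective (_ ∷ _)    {zero}  {zero}  _  = refl
  Unique⇒lookup-injective (x∉xs ∷ _) {zero}  {suc j} eq = contradiction eq (All.lookup x∉xs (∈-lookup j))
  Unique⇒lookup-injective (x∉xs ∷ _) {suc i} {zero}  eq = contradiction (sym eq) (All.lookup x∉xs (∈-lookup i))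
  Unique⇒lookup-injective (_ ∷ xs!)  {suc i} {suc j} eq = cong suc (Unique⇒lookup-injective xs! eq)

  length-filter-∁ : ∀ {P : A → Set} (P? : Decidable P) xs →
                    length (filter P? xs) + length (filter (∁? P?) xs) ≡ length xs
  length-filter-∁ P? []       = refl
  length-filter-∁ P? (x ∷ xs) with P? x
  ... | yes _ = cong suc (length-filter-∁ P? xs)
  ... | no _  = trans (+-suc _ _) (cong suc (length-filter-∁ P? xs))

  ∀∈? : ∀ {P : A → Set} → Decidable P → ∀ xs → Dec (∀ x → x ∈ xs → P x)
  ∀∈? P? xs = Dec.map′ (λ all _ → All.lookup all) (λ f → All.tabulate (f _)) (All.all? P? xs)

  ∀∈²? : ∀ {R : A → A → Set} → (∀ x y → Dec (R x y)) → ∀ xs → Dec (∀ x y → x ∈ xs → y ∈ xs → R x y)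
  ∀∈²? R? xs = Dec.map′ (λ f x y x∈xs y∈xs → f x x∈xs y y∈xs) (λ f x x∈xs y y∈xs → f x y x∈xs y∈xs)
                        (∀∈? (λ x → ∀∈? (R? x) xs) xs)

_⇔-dec_ : ∀ {P Q : Set} → Dec P → Dec Q → Dec (P ⇔ Q)
P? ⇔-dec Q? = Dec.map′ (λ (f , g) → mk⇔ f g) (λ P⇔Q → to P⇔Q , from P⇔Q) ((P? →-dec Q?) ×-dec (Q? →-dec P?))

map-preimage : ∀ {A B : Set} (f : A → B) {ys} → All (λ y → ∃ λ x → f x ≡ y) ys → ∃ λ xs → map f xs ≡ ys
map-preimage f []               = [] , refl
map-preimage f ((x , refl) ∷ ps) = Product.map (x ∷_) (cong (f x ∷_)) (map-preimage f ps)

-- Backedge graphs and ω⃗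

module _ {n : ℕ} (T : Tournament n) where
  open Tournament T
  open import Data.List.Membership.DecPropositional (_≟_ {n}) using (_∈?_)
  open import Data.List.Relation.Binary.Sublist.DecPropositional (_≟_ {n}) using (_⊆?_)
  open import Data.List.Relation.Unary.Unique.DecPropositional (_≟_ {n}) using (unique?)

  Precedes⇒⊆ : ∀ {L u v} → Precedes T L u v → u ∷ [ v ] ⊆ L
  Precedes⇒⊆ ([] , _ , refl , v∈ys)     = refl ∷ from∈ v∈ys
  Precedes⇒⊆ (x ∷ xs , ys , refl , v∈ys) = x ∷ʳ Precedes⇒⊆ (xs , ys , refl , v∈ys)

  ⊆⇒Precedes : ∀ {L u v} → u ∷ [ v ] ⊆ L → Precedes T L u v
  ⊆⇒Precedes (refl ∷ τ) = [] , _ , refl , to∈ τ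
  ⊆⇒Precedes (x ∷ʳ τ) with ⊆⇒Precedes τ
  ... | xs , ys , refl , v∈ys = x ∷ xs , ys , refl , v∈ys

  Precedes-⊆ : ∀ {L₁ L₂ u v} → L₁ ⊆ L₂ → Precedes T L₁ u v → Precedes T L₂ u v
  Precedes-⊆ τ = ⊆⇒Precedes ∘ (λ σ → ⊆-trans σ τ) ∘ Precedes⇒⊆

  Precedes-total : ∀ {L u v} → u ∈ L → v ∈ L → u ≢ v → Precedes T L u v ⊎ Precedes T L v u
  Precedes-total u∈L v∈L u≢v = Sum.map ⊆⇒Precedes ⊆⇒Precedes (⊆-pair-total u∈L v∈L u≢v)

  Precedes-asym : ∀ {L u v} → Unique L → Precedes T L u v → ¬ Precedes T L v u
  Precedes-asym L! uv vu = Unique⇒⊆-pair-asym L! (Precedes⇒⊆ uv) (Precedes⇒⊆ vu)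

  Precedes? : ∀ L u v → Dec (Precedes T L u v)
  Precedes? L u v = Dec.map′ ⊆⇒Precedes Precedes⇒⊆ (u ∷ [ v ] ⊆? L)

  Arc? : ∀ u v → Dec (Arc T u v)
  Arc? u v = arc u v Bool.≟ true

  N⁺? : ∀ v → Decidable (N⁺ T v)
  N⁺? v = Arc? v

  N⁻? : ∀ v → Decidable (N⁻ T v)
  N⁻? v u = Arc? u v

  BackEdge? : ∀ L u v → Dec (BackEdge T L u v)
  BackEdge? L u v = (Precedes? L u v ×-dec Arc? v u) ⊎-dec (Precedes? L v u ×-dec Arc? u v)

  BackEdge-⊆ : ∀ {L₁ L₂ u v} → L₁ ⊆ L₂ → BackEdge T L₁ u v → BackEdge T L₂ u v
  BackEdge-⊆ τ = Sum.map (Product.map₁ (Precedes-⊆ τ)) (Product.map₁ (Precedes-⊆ τ))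

  BackEdge-⊆⁻ : ∀ {L₁ L₂ u v} → Unique L₂ → L₁ ⊆ L₂ → u ∈ L₁ → v ∈ L₁ → u ≢ v →
                BackEdge T L₂ u v → BackEdge T L₁ u v
  BackEdge-⊆⁻ L₂! τ u∈L₁ v∈L₁ u≢v e with Precedes-total u∈L₁ v∈L₁ u≢v | e
  ... | inj₁ uv | inj₁ (_ , a)  = inj₁ (uv , a)
  ... | inj₁ uv | inj₂ (vu , _) = contradiction vu (Precedes-asym L₂! (Precedes-⊆ τ uv))
  ... | inj₂ vu | inj₂ (_ , a)  = inj₂ (vu , a)
  ... | inj₂ vu | inj₁ (uv , _) = contradiction uv (Precedes-asym L₂! (Precedes-⊆ τ vu))

  []-isClique : ∀ {L} → IsClique T L []
  []-isClique = [] , (λ _ ()) , λ _ _ ()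

  IsClique-⊆ : ∀ {L₁ L₂ K} → L₁ ⊆ L₂ → IsClique T L₁ K → IsClique T L₂ K
  IsClique-⊆ τ (K! , K⊆L₁ , edges) =
    K! , (λ u u∈K → ⊆-lookup τ (K⊆L₁ u u∈K)) , λ u v u∈K v∈K u≢v → BackEdge-⊆ τ (edges u v u∈K v∈K u≢v)

  IsClique-⊆⁻ : ∀ {L₁ L₂ K} → Unique L₂ → L₁ ⊆ L₂ → (∀ u → u ∈ K → u ∈ L₁) →
                IsClique T L₂ K → IsClique T L₁ K
  IsClique-⊆⁻ L₂! τ K⊆L₁ (K! , _ , edges) = K! , K⊆L₁ , λ u v u∈K v∈K u≢v →
    BackEdge-⊆⁻ L₂! τ (K⊆L₁ u u∈K) (K⊆L₁ v v∈K) u≢v (edges u v u∈K v∈K u≢v)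

  IsClique-subset : ∀ {L K K′} → Unique K′ → (∀ {u} → u ∈ K′ → u ∈ K) → IsClique T L K → IsClique T L K′
  IsClique-subset K′! K′⊆K (_ , K⊆L , edges) =
    K′! , (λ u u∈K′ → K⊆L u (K′⊆K u∈K′)) , λ u v u∈K′ v∈K′ → edges u v (K′⊆K u∈K′) (K′⊆K v∈K′)

  IsClique? : ∀ L K → Dec (IsClique T L K)
  IsClique? L K = unique? K ×-dec ∀∈? (_∈? L) K ×-dec ∀∈²? (λ u v → ¬? (u ≟ v) →-dec BackEdge? L u v) K

  maximumClique : List (Fin n) → List (Fin n)
  maximumClique L = argmax length [] (filter (IsClique? L) (sublists L))

  cliqueNumber : List (Fin n) → ℕ
  cliqueNumber L = length (maximumClique L)

  maximumClique-isClique : ∀ L → IsClique T L (maximumClique L)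
  maximumClique-isClique L = argmax-all length []-isClique (all-filter (IsClique? L) (sublists L))

  isCliqueNumber : ∀ {L} → Unique L → IsCliqueNumber T L (cliqueNumber L)
  isCliqueNumber {L} L! = (maximumClique L , maximumClique-isClique L , refl) , maximal
    where
      maximal : ∀ K → IsClique T L K → length K ≤ cliqueNumber L
      maximal K K-clique@(K! , K⊆L , _) = begin
        length K       ≡⟨ Unique∧set⇒length≡ K! K′! (mk⇔ (λ u∈K → ∈-filter⁺ (_∈? K) (K⊆L _ u∈K) u∈K) K′⊆K) ⟩
        length K′      ≤⟨ All.lookup (f[xs]≤f[argmax] {f = length} [] _) K′-candidate ⟩
        cliqueNumber L ∎
        where
          open ≤-Reasoning
          K′ = filter (_∈? K) L
          K′! = filter⁺ (_∈? K) L!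
          K′⊆K : ∀ {u} → u ∈ K′ → u ∈ K
          K′⊆K = proj₂ ∘ ∈-filter⁻ (_∈? K) {xs = L}
          K′-candidate : K′ ∈ filter (IsClique? L) (sublists L)
          K′-candidate = ∈-filter⁺ (IsClique? L) (∈-sublists (filter-⊆ (_∈? K) L)) (IsClique-subset K′! K′⊆K K-clique)

  IsCliqueNumber-unique : ∀ {L c₁ c₂} → IsCliqueNumber T L c₁ → IsCliqueNumber T L c₂ → c₁ ≡ c₂
  IsCliqueNumber-unique ((K₁ , K₁-clique , refl) , maximal₁) ((K₂ , K₂-clique , refl) , maximal₂) =
    ≤-antisym (maximal₂ K₁ K₁-clique) (maximal₁ K₂ K₂-clique)

  IsCliqueNumber-⊆ : ∀ {L₁ L₂ c₁ c₂} → L₁ ⊆ L₂ → IsCliqueNumber T L₁ c₁ → IsCliqueNumber T L₂ c₂ → c₁ ≤ c₂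
  IsCliqueNumber-⊆ τ ((K , K-clique , refl) , _) (_ , maximal) = maximal K (IsClique-⊆ τ K-clique)

  IsOrdering-length : ∀ {X : VSet T} {L₁ L₂} → IsOrdering T X L₁ → IsOrdering T X L₂ → length L₁ ≡ length L₂
  IsOrdering-length (L₁! , X⇔L₁) (L₂! , X⇔L₂) =
    Unique∧set⇒length≡ L₁! L₂! (⇔.trans (⇔.sym (X⇔L₁ _)) (X⇔L₂ _))

  IsOrdering? : ∀ {X : VSet T} → Decidable X → ∀ L → Dec (IsOrdering T X L)
  IsOrdering? X? L = unique? L ×-dec all? (λ v → X? v ⇔-dec (v ∈? L))

  filter-isOrdering : ∀ {X : VSet T} (X? : Decidable X) → IsOrdering T X (filter X? (allFin n))
  filter-isOrdering X? =
    filter⁺ X? (allFin⁺ n) , λ v → mk⇔ (∈-filter⁺ X? (∈-allFin v)) (proj₂ ∘ ∈-filter⁻ X? {xs = allFin n})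

  IsOrdering-resp-⇔ : ∀ {X Y : VSet T} {L} → (∀ v → X v ⇔ Y v) → IsOrdering T X L → IsOrdering T Y L
  IsOrdering-resp-⇔ X⇔Y (L! , X⇔L) = L! , λ v → ⇔.trans (⇔.sym (X⇔Y v)) (X⇔L v)

  ++-isOrdering : ∀ {X P : VSet T} {L₁ L₂} → Decidable P →
                  IsOrdering T (X ∩ P) L₁ → IsOrdering T (X ∩ ∁ P) L₂ → IsOrdering T X (L₁ ++ L₂)
  ++-isOrdering {X} {P} {L₁} {L₂} P? (L₁! , L₁-exact) (L₂! , L₂-exact) =
    Unique.++⁺ L₁! L₂! disjoint , λ v → mk⇔ (into v) from++
    where
      disjoint : ∀ {v} → ¬ (v ∈ L₁ × v ∈ L₂)
      disjoint (v∈L₁ , v∈L₂) = proj₂ (from (L₂-exact _) v∈L₂) (proj₂ (from (L₁-exact _) v∈L₁))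
      into : ∀ v → X v → v ∈ L₁ ++ L₂
      into v Xv with P? v
      ... | yes Pv = ∈-++⁺ˡ (to (L₁-exact v) (Xv , Pv))
      ... | no ¬Pv = ∈-++⁺ʳ L₁ (to (L₂-exact v) (Xv , ¬Pv))
      from++ : ∀ {v} → v ∈ L₁ ++ L₂ → X v
      from++ = [ proj₁ ∘ from (L₁-exact _) , proj₁ ∘ from (L₂-exact _) ]′ ∘ ∈-++⁻ L₁

  IsClique-restrict : ∀ {L L′ K} {Q : VSet T} → Unique L → L′ ⊆ L → (Q? : Decidable Q) →
                      (∀ {u} → u ∈ L → Q u → u ∈ L′) → IsClique T L K → IsClique T L′ (filter Q? K)
  IsClique-restrict {K = K} L! τ Q? block K-clique@(K! , K⊆L , _) =
    IsClique-⊆⁻ L! τ (λ u u∈KQ → let (u∈K , Qu) = ∈-filter⁻ Q? {xs = K} u∈KQ in block (K⊆L u u∈K) Qu)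
      (IsClique-subset (filter⁺ Q? K!) (proj₁ ∘ ∈-filter⁻ Q? {xs = K}) K-clique)

  orderingCandidates : ∀ {X : VSet T} → Decidable X → List (List (Fin n))
  orderingCandidates X? =
    filter (IsOrdering? X?) (listsOfLength (allFin n) (length (filter X? (allFin n))))

  ∈-orderingCandidates : ∀ {X : VSet T} (X? : Decidable X) {L} → IsOrdering T X L → L ∈ orderingCandidates X?
  ∈-orderingCandidates X? {L} L-ordering = ∈-filter⁺ (IsOrdering? X?) L∈lists L-ordering
    where
      L∈lists : L ∈ listsOfLength (allFin n) (length (filter X? (allFin n)))
      L∈lists = subst ((L ∈_) ∘ listsOfLength (allFin n)) (IsOrdering-length L-ordering (filter-isOrdering X?))
                      (∈-listsOfLength (All.tabulate λ {v} _ → ∈-allFin v))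

  optimalOrdering : ∀ {X : VSet T} → Decidable X → List (Fin n)
  optimalOrdering X? = argmin cliqueNumber (filter X? (allFin n)) (orderingCandidates X?)

  optimalOrdering-isOrdering : ∀ {X : VSet T} (X? : Decidable X) → IsOrdering T X (optimalOrdering X?)
  optimalOrdering-isOrdering X? =
    argmin-all cliqueNumber (filter-isOrdering X?)
      (all-filter (IsOrdering? X?) (listsOfLength (allFin n) (length (filter X? (allFin n)))))

  optimalOrdering-optimal : ∀ {X : VSet T} (X? : Decidable X) {L} → IsOrdering T X L →
                            cliqueNumber (optimalOrdering X?) ≤ cliqueNumber L
  optimalOrdering-optimal X? L-ordering =
    All.lookup (f[argmin]≤f[xs] _ (orderingCandidates X?)) (∈-orderingCandidates X? L-ordering)

  -- Opaque so that the type checker never unfolds the exhaustive search.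
  opaque
    omegaVec : ∀ {X : VSet T} → Decidable X → ∃ (IsOmegaVec T X)
    omegaVec {X} X? = cliqueNumber L* , (L* , L*-ordering , isCliqueNumber (proj₁ L*-ordering)) , minimal
      where
        L* : List (Fin n)
        L* = optimalOrdering X?
        L*-ordering : IsOrdering T X L*
        L*-ordering = optimalOrdering-isOrdering X?
        minimal : ∀ L c → IsOrdering T X L → IsCliqueNumber T L c → cliqueNumber L* ≤ c
        minimal L c L-ordering L-cn =
          ≤-trans (optimalOrdering-optimal X? L-ordering)
                  (≤-reflexive (IsCliqueNumber-unique (isCliqueNumber (proj₁ L-ordering)) L-cn))

  IsOmegaVec-unique : ∀ {X : VSet T} {m₁ m₂} → IsOmegaVec T X m₁ → IsOmegaVec T X m₂ → m₁ ≡ m₂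
  IsOmegaVec-unique ((L₁ , L₁-ordering , L₁-cn) , minimal₁) ((L₂ , L₂-ordering , L₂-cn) , minimal₂) =
    ≤-antisym (minimal₁ L₂ _ L₂-ordering L₂-cn) (minimal₂ L₁ _ L₁-ordering L₁-cn)

  IsOmegaVec-≤-cliqueNumber : ∀ {X : VSet T} {m L} → IsOmegaVec T X m → IsOrdering T X L → m ≤ cliqueNumber L
  IsOmegaVec-≤-cliqueNumber (_ , minimal) L-ordering =
    minimal _ _ L-ordering (isCliqueNumber (proj₁ L-ordering))

  IsOmegaVec-resp-⇔ : ∀ {X Y : VSet T} {m} → (∀ v → X v ⇔ Y v) → IsOmegaVec T X m → IsOmegaVec T Y m
  IsOmegaVec-resp-⇔ X⇔Y ((L , L-ordering , L-cn) , minimal) =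
    (L , IsOrdering-resp-⇔ X⇔Y L-ordering , L-cn) ,
    λ L′ c L′-ordering → minimal L′ c (IsOrdering-resp-⇔ (⇔.sym ∘ X⇔Y) L′-ordering)

  OmegaVec≥? : ∀ {X : VSet T} → Decidable X → ∀ k → Dec (OmegaVec≥ T X k)
  OmegaVec≥? X? k with omegaVec X?
  ... | m , ω = Dec.map′ (λ k≤m → m , ω , k≤m)
                         (λ (_ , ω′ , k≤m′) → subst (k ≤_) (IsOmegaVec-unique ω′ ω) k≤m′)
                         (k ≤? m)

  IsOmegaVec-mono : ∀ {X Y : VSet T} {m₁ m₂} → Decidable Y → (∀ {v} → Y v → X v) →
                    IsOmegaVec T Y m₁ → IsOmegaVec T X m₂ → m₁ ≤ m₂
  IsOmegaVec-mono Y? Y⊆X ω-Y ((L , (L! , X⇔L) , L-cn) , _) =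
    ≤-trans (IsOmegaVec-≤-cliqueNumber ω-Y L′-ordering)
            (IsCliqueNumber-⊆ (filter-⊆ Y? L) (isCliqueNumber (proj₁ L′-ordering)) L-cn)
    where
      L′-ordering : IsOrdering T _ (filter Y? L)
      L′-ordering = filter⁺ Y? L! ,
                    λ v → mk⇔ (λ Yv → ∈-filter⁺ Y? (to (X⇔L v) (Y⊆X Yv)) Yv) (proj₂ ∘ ∈-filter⁻ Y? {xs = L})

  IsOmegaVec-subadditive : ∀ {X P : VSet T} {m m₁ m₂} → Decidable P → IsOmegaVec T X m →
                           IsOmegaVec T (X ∩ P) m₁ → IsOmegaVec T (X ∩ ∁ P) m₂ → m ≤ m₁ + m₂
  IsOmegaVec-subadditive {X} {P} {m} {m₁} {m₂} P? ω
    ((L₁ , L₁-ordering , _ , maximal₁) , _) ((L₂ , L₂-ordering , _ , maximal₂) , _) = begin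
    m                     ≤⟨ IsOmegaVec-≤-cliqueNumber ω L-ordering ⟩
    length K              ≡⟨ length-filter-∁ P? K ⟨
    length K₁ + length K₂ ≤⟨ +-mono-≤ (maximal₁ K₁ K₁-clique) (maximal₂ K₂ K₂-clique) ⟩
    m₁ + m₂               ∎
    where
      open ≤-Reasoning
      L = L₁ ++ L₂
      L-ordering = ++-isOrdering P? L₁-ordering L₂-ordering
      K = maximumClique L
      K₁ = filter P? K
      K₂ = filter (∁? P?) K
      X-of : ∀ {v} → v ∈ L → X v
      X-of = from (proj₂ L-ordering _)
      K₁-clique : IsClique T L₁ K₁
      K₁-clique = IsClique-restrict (proj₁ L-ordering) (++⁺ʳ L₂ ⊆-refl) P?
                    (λ v∈L Pv → to (proj₂ L₁-ordering _) (X-of v∈L , Pv)) (maximumClique-isClique L)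
      K₂-clique : IsClique T L₂ K₂
      K₂-clique = IsClique-restrict (proj₁ L-ordering) (++⁺ˡ L₁ ⊆-refl) (∁? P?)
                    (λ v∈L ¬Pv → to (proj₂ L₂-ordering _) (X-of v∈L , ¬Pv)) (maximumClique-isClique L)

  OmegaVec≥-nonempty : ∀ {X : VSet T} {k} → NonZero k → OmegaVec≥ T X k → ∃ X
  OmegaVec≥-nonempty k≢0 (_ , ((L , (_ , X⇔L) , (K , (_ , K⊆L , _) , refl) , _) , _) , k≤|K|)
    with K | K⊆L | ≤-trans (>-nonZero⁻¹ _ {{k≢0}}) k≤|K|
  ... | u ∷ _ | K⊆L′ | _ = u , from (X⇔L u) (K⊆L′ u (here refl))

-- Embeddings and induced subtournaments

module Embedding {k n} {T′ : Tournament k} {T : Tournament n}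
                 (e : Fin k → Fin n) (e-injective : Injective _≡_ _≡_ e)
                 (arc-≡ : ∀ i j → Tournament.arc T′ i j ≡ Tournament.arc T (e i) (e j)) where

  ∈-map⁻-injective : ∀ {j L} → e j ∈ map e L → j ∈ L
  ∈-map⁻-injective {j} {L} ej∈eL with ∈-map⁻ e ej∈eL
  ... | j′ , j′∈L , ej≡ej′ = subst (_∈ L) (sym (e-injective ej≡ej′)) j′∈L

  ∈-map⇒image : ∀ {v L} → v ∈ map e L → ∃ λ j → e j ≡ v
  ∈-map⇒image v∈eL = let (j , _ , v≡ej) = ∈-map⁻ e v∈eL in j , sym v≡ej

  Precedes-map⁺ : ∀ {L i j} → Precedes T′ L i j → Precedes T (map e L) (e i) (e j)
  Precedes-map⁺ = ⊆⇒Precedes T ∘ map⁺ e ∘ Precedes⇒⊆ T′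

  Precedes-map⁻ : ∀ {L i j} → Precedes T (map e L) (e i) (e j) → Precedes T′ L i j
  Precedes-map⁻ = ⊆⇒Precedes T′ ∘ Sublist.map e-injective ∘ Sublist.map⁻ e e ∘ Precedes⇒⊆ T

  BackEdge-map⁺ : ∀ {L i j} → BackEdge T′ L i j → BackEdge T (map e L) (e i) (e j)
  BackEdge-map⁺ {i = i} {j} = Sum.map (Product.map Precedes-map⁺ (trans (sym (arc-≡ j i))))
                                      (Product.map Precedes-map⁺ (trans (sym (arc-≡ i j))))

  BackEdge-map⁻ : ∀ {L i j} → BackEdge T (map e L) (e i) (e j) → BackEdge T′ L i j
  BackEdge-map⁻ {i = i} {j} = Sum.map (Product.map Precedes-map⁻ (trans (arc-≡ j i)))
                                      (Product.map Precedes-map⁻ (trans (arc-≡ i j)))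

  IsClique-map⁺ : ∀ {L K} → IsClique T′ L K → IsClique T (map e L) (map e K)
  IsClique-map⁺ {L} {K} (K! , K⊆L , edges) = Unique.map⁺ e-injective K! , members , pairs
    where
      members : ∀ v → v ∈ map e K → v ∈ map e L
      members _ v∈eK with ∈-map⁻ e v∈eK
      ... | j , j∈K , refl = ∈-map⁺ e (K⊆L j j∈K)
      pairs : ∀ u v → u ∈ map e K → v ∈ map e K → u ≢ v → BackEdge T (map e L) u v
      pairs _ _ u∈eK v∈eK u≢v with ∈-map⁻ e u∈eK | ∈-map⁻ e v∈eK
      ... | i , i∈K , refl | j , j∈K , refl = BackEdge-map⁺ (edges i j i∈K j∈K (u≢v ∘ cong e))

  IsClique-map⁻ : ∀ {L K} → IsClique T (map e L) (map e K) → IsClique T′ L K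
  IsClique-map⁻ (eK! , eK⊆eL , edges) =
    Unique.map⁻ eK! , (λ j j∈K → ∈-map⁻-injective (eK⊆eL _ (∈-map⁺ e j∈K))) ,
    λ i j i∈K j∈K i≢j → BackEdge-map⁻ (edges _ _ (∈-map⁺ e i∈K) (∈-map⁺ e j∈K) (i≢j ∘ e-injective))

  IsCliqueNumber-map : ∀ {L c} → IsCliqueNumber T′ L c → IsCliqueNumber T (map e L) c
  IsCliqueNumber-map {L} ((K , K-clique , refl) , maximal) =
    (map e K , IsClique-map⁺ K-clique , length-map e K) , maximal′
    where
      maximal′ : ∀ K′ → IsClique T (map e L) K′ → length K′ ≤ length K
      maximal′ K′ K′-clique@(_ , K′⊆eL , _)
        with map-preimage e (All.tabulate λ v∈K′ → ∈-map⇒image (K′⊆eL _ v∈K′))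
      ... | J , refl = subst (_≤ length K) (sym (length-map e J)) (maximal J (IsClique-map⁻ K′-clique))

  module _ {Y : VSet T′} {Z : VSet T}
           (Z-image : ∀ {v} → Z v → ∃ λ j → e j ≡ v) (Z⇔Y : ∀ j → Z (e j) ⇔ Y j) where

    IsOrdering-map⁺ : ∀ {L} → IsOrdering T′ Y L → IsOrdering T Z (map e L)
    IsOrdering-map⁺ {L} (L! , Y⇔L) = Unique.map⁺ e-injective L! , λ v → mk⇔ into (out v)
      where
        into : ∀ {v} → Z v → v ∈ map e L
        into Zv with Z-image Zv
        ... | j , refl = ∈-map⁺ e (to (Y⇔L j) (to (Z⇔Y j) Zv))
        out : ∀ v → v ∈ map e L → Z v
        out _ v∈eL with ∈-map⁻ e v∈eL
        ... | j , j∈L , refl = from (Z⇔Y j) (from (Y⇔L j) j∈L)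

    IsOrdering-map⁻ : ∀ {L} → IsOrdering T Z (map e L) → IsOrdering T′ Y L
    IsOrdering-map⁻ (eL! , Z⇔eL) =
      Unique.map⁻ eL! , λ j → mk⇔ (∈-map⁻-injective ∘ to (Z⇔eL _) ∘ from (Z⇔Y j))
                                  (to (Z⇔Y j) ∘ from (Z⇔eL _) ∘ ∈-map⁺ e)

    IsOmegaVec-map : ∀ {m} → IsOmegaVec T′ Y m → IsOmegaVec T Z m
    IsOmegaVec-map {m} ω@((L , L-ordering , L-cn) , _) =
      (map e L , IsOrdering-map⁺ L-ordering , IsCliqueNumber-map L-cn) , minimal
      where
        minimal : ∀ L′ c → IsOrdering T Z L′ → IsCliqueNumber T L′ c → m ≤ c
        minimal L′ c L′-ordering@(_ , Z⇔L′) L′-cn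
          with map-preimage e (All.tabulate λ v∈L′ → Z-image (from (Z⇔L′ _) v∈L′))
        ... | J , refl = begin
          m                  ≤⟨ IsOmegaVec-≤-cliqueNumber T′ ω J-ordering ⟩
          cliqueNumber T′ J  ≡⟨ IsCliqueNumber-unique T (IsCliqueNumber-map (isCliqueNumber T′ (proj₁ J-ordering))) L′-cn ⟩
          c                  ∎
          where
            open ≤-Reasoning
            J-ordering = IsOrdering-map⁻ L′-ordering

module Induced {n} (T : Tournament n) {S : VSet T} (S? : Decidable S) where
  open Tournament T

  vertices : List (Fin n)
  vertices = filter S? (allFin n)

  embed : Fin (length vertices) → Fin n
  embed = lookup vertices

  embed-injective : Injective _≡_ _≡_ embed
  embed-injective = Unique⇒lookup-injective (filter⁺ S? (allFin⁺ n))

  embed-∈ : ∀ j → S (embed j)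
  embed-∈ j = proj₂ (∈-filter⁻ S? {xs = allFin n} (∈-lookup j))

  embed-surjective : ∀ {v} → S v → ∃ λ j → embed j ≡ v
  embed-surjective {v} Sv = index v∈vertices , sym (lookup-index v∈vertices)
    where v∈vertices = ∈-filter⁺ S? (∈-allFin v) Sv

  induced : Tournament (length vertices)
  induced = record
    { arc     = λ i j → arc (embed i) (embed j)
    ; irrefl  = irrefl ∘ embed
    ; total   = λ i j i≢j → total (embed i) (embed j) (i≢j ∘ embed-injective)
    ; antisym = λ i j → antisym (embed i) (embed j)
    }

  open Embedding {T′ = induced} {T = T} embed embed-injective (λ _ _ → refl)

  OmegaVec≥-induced : ∀ {x} → OmegaVec≥ T S x → OmegaVec≥ induced (Vall induced) x
  OmegaVec≥-induced {x} (m , ω-S , x≤m) with omegaVec induced {Vall induced} (λ _ → yes tt)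
  ... | m′ , ω′ = m′ , ω′ , subst (x ≤_) (IsOmegaVec-unique T ω-S ω-S′) x≤m
    where
      ω-S′ = IsOmegaVec-map embed-surjective (λ j → mk⇔ _ (λ _ → embed-∈ j)) ω′

  OmegaVec≥-embed : ∀ {Y : VSet induced} {Z : VSet T} {x} → Decidable Z → (∀ j → Z (embed j) ⇔ Y j) →
                    OmegaVec≥ induced Y x → OmegaVec≥ T Z x
  OmegaVec≥-embed {Y} {Z} Z? Z⇔Y (r , ω-Y , x≤r) with omegaVec T Z?
  ... | m , ω-Z = m , ω-Z , ≤-trans x≤r (IsOmegaVec-mono T (Z? ∩? S?) proj₁ ω-Z∩S ω-Z)
    where
      Z∩S⇔Y : ∀ j → (Z ∩ S) (embed j) ⇔ Y j
      Z∩S⇔Y j = mk⇔ (to (Z⇔Y j) ∘ proj₁) (λ Yj → from (Z⇔Y j) Yj , embed-∈ j)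
      ω-Z∩S = IsOmegaVec-map (embed-surjective ∘ proj₂) Z∩S⇔Y ω-Y

-- The set B

ForcesOutRichVertex : (ℕ → ℕ) → ℕ → Set
ForcesOutRichVertex g x =
  ∀ {k} (T : Tournament k) → OmegaVec≥ T (Vall T) (g x) → ∃ λ v → OmegaVec≥ T (N⁺ T v) x

ForcesInRichVertex : (ℕ → ℕ) → ℕ → Set
ForcesInRichVertex g x =
  ∀ {k} (T : Tournament k) → OmegaVec≥ T (Vall T) (g x) → ∃ λ v → OmegaVec≥ T (N⁻ T v) x

module _ (g : ℕ → ℕ) {x : ℕ} {n} (T : Tournament n) {S : VSet T} (S? : Decidable S) where
  open Induced T S?

  out-poor⇒ω⃗<g : ForcesOutRichVertex g x → (∀ {v} → S v → ¬ OmegaVec≥ T (N⁺ T v) x) →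
                  ∀ {m} → IsOmegaVec T S m → m < g x
  out-poor⇒ω⃗<g forces poor ω-S = ≰⇒> λ gx≤m →
    let (i , rich) = forces induced (OmegaVec≥-induced (_ , ω-S , gx≤m))
    in poor (embed-∈ i) (OmegaVec≥-embed (N⁺? T (embed i)) (λ _ → ⇔.refl) rich)

  in-poor⇒ω⃗<g : ForcesInRichVertex g x → (∀ {v} → S v → ¬ OmegaVec≥ T (N⁻ T v) x) →
                 ∀ {m} → IsOmegaVec T S m → m < g x
  in-poor⇒ω⃗<g forces poor ω-S = ≰⇒> λ gx≤m →
    let (i , rich) = forces induced (OmegaVec≥-induced (_ , ω-S , gx≤m))
    in poor (embed-∈ i) (OmegaVec≥-embed (N⁻? T (embed i)) (λ _ → ⇔.refl) rich)

ω⃗≤2g-outside-BigSet : ∀ (g : ℕ → ℕ) {b} → ForcesOutRichVertex g b → ForcesInRichVertex g b →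
                       ∀ {n} (T : Tournament n) {S : VSet T} → Decidable S → (∀ {v} → S v → ¬ BigSet T b v) →
                       ∀ {r} → IsOmegaVec T S r → r ≤ 2 * g b
ω⃗≤2g-outside-BigSet g {b} forces⁺ forces⁻ T {S} S? S∩B=∅ {r} ω-S =
  split (omegaVec T (S? ∩? out-poor?)) (omegaVec T (S? ∩? ∁? out-poor?))
  where
    open ≤-Reasoning
    OutPoor : VSet T
    OutPoor v = ¬ OmegaVec≥ T (N⁺ T v) b
    out-poor? : Decidable OutPoor
    out-poor? v = ¬? (OmegaVec≥? T (N⁺? T v) b)
    in-poor : ∀ {v} → (S ∩ ∁ OutPoor) v → ¬ OmegaVec≥ T (N⁻ T v) b
    in-poor (Sv , ¬out-poor) in-rich = S∩B=∅ Sv (in-rich , decidable-stable (OmegaVec≥? T (N⁺? T _) b) ¬out-poor)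
    split : ∃ (IsOmegaVec T (S ∩ OutPoor)) → ∃ (IsOmegaVec T (S ∩ ∁ OutPoor)) → r ≤ 2 * g b
    split (o₁ , ω₁) (o₂ , ω₂) = begin
      r         ≤⟨ IsOmegaVec-subadditive T out-poor? ω-S ω₁ ω₂ ⟩
      o₁ + o₂   ≤⟨ +-mono-≤ (<⇒≤ (out-poor⇒ω⃗<g g T (S? ∩? out-poor?) forces⁺ proj₂ ω₁))
                            (<⇒≤ (in-poor⇒ω⃗<g g T (S? ∩? ∁? out-poor?) forces⁻ in-poor ω₂)) ⟩
      g b + g b ≡⟨ cong (g b +_) (+-identityʳ (g b)) ⟨
      2 * g b   ∎

lemma5p1 : (g : ℕ → ℕ)
    → (∀ (x n' : ℕ) (T' : Tournament n') → OmegaVec≥ T' (Vall T') (g x)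
        → (∃ λ v → OmegaVec≥ T' (N⁺ T' v) x) × (∃ λ v → OmegaVec≥ T' (N⁻ T' v) x))
    → (b C : ℕ) → NonZero b → NonZero C
    → (n : ℕ) (T : Tournament n) → IsOmegaVec T (Vall T) (2 * g b + C)
    → OmegaVec≥ T (BigSet T b) C × (∃ λ v → BigSet T b v)
lemma5p1 g hyp b C _ C≢0 n T ω-V = B-large , OmegaVec≥-nonempty T C≢0 B-large
  where
    B? : Decidable (BigSet T b)
    B? v = OmegaVec≥? T (N⁻? T v) b ×-dec OmegaVec≥? T (N⁺? T v) b
    V? : Decidable (Vall T)
    V? _ = yes tt
    forces⁺ : ForcesOutRichVertex g b
    forces⁺ T′ = proj₁ ∘ hyp b _ T′
    forces⁻ : ForcesInRichVertex g b
    forces⁻ T′ = proj₂ ∘ hyp b _ T′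
    B-large : OmegaVec≥ T (BigSet T b) C
    B-large with omegaVec T (V? ∩? B?) | omegaVec T (V? ∩? ∁? B?)
    ... | β , ω-B | r , ω-rest = β , IsOmegaVec-resp-⇔ T (λ _ → mk⇔ proj₂ (tt ,_)) ω-B , C≤β
      where
        open ≤-Reasoning
        C≤β : C ≤ β
        C≤β = +-cancelʳ-≤ (2 * g b) C β (begin
          C + 2 * g b ≡⟨ +-comm C (2 * g b) ⟩
          2 * g b + C ≤⟨ IsOmegaVec-subadditive T B? ω-V ω-B ω-rest ⟩
          β + r       ≤⟨ +-monoʳ-≤ β (ω⃗≤2g-outside-BigSet g forces⁺ forces⁻ T (V? ∩? ∁? B?) proj₂ ω-rest) ⟩
          β + 2 * g b ∎)
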